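{- Let $r$ be a positive integer and let $\lambda^{(r)}=(1,\dots,1)$ be the ordered partition of $r$ into $r$ parts. For every $r$-pattern $P\in\mathcal{P}(\lambda^{(r)})$ let $m_P$ be a positive integer. Then there exists an $r$-partite ordered $r$-uniform hypergraph matching $\mathcal{H}$ with \[|\mathcal{H}|=\prod_{P\in\mathcal{P}(\lambda^{(r)})} m_P,\] such that for every $P\in\mathcal{P}(\lambda^{(r)})$ every $P$-clique in $\mathcal{H}$ has size at most $m_P$, and for every $r$-pattern $P\notin\mathcal{P}(\lambda^{(r)})$ every $P$-clique in $\mathcal{H}$ has size at most $1$.
   Context: An $r$-uniform hypergraph matching is a finite collection of pairwise disjoint sets (edges), each of size $r$; an ordered one additionally has a total ordering of its vertex set. It is $r$-partite if, for each $i=1,\dots,r-1$, the $i$-th smallest vertices of all edges come before the $(i+1)$-th smallest vertices of all edges. An $r$-pattern is a string in $\{\mathrm{A},\mathrm{B}\}^{2r}$ starting with $\mathrm{A}$ with exactly $r$ letters $\mathrm{A}$ and $r$ letters $\mathrm{B}$. Two distinct edges $e,f$ form the $r$-pattern obtained by listing the vertices of $e\cup f$ in increasing order, writing $\mathrm{A}$ for vertices of the edge containing the smallest vertex and $\mathrm{B}$ for the other. A $P$-clique is a set of edges any two distinct of which form $P$; its size is its number of edges. $\mathcal{P}((1,\dots,1))$ is the set of $r$-patterns that are concatenations of $r$ blocks each equal to $\mathrm{AB}$ or $\mathrm{BA}$ (starting with $\mathrm{A}$). -}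

module Defs where

open import Data.Nat using (ℕ; zero; suc; _+_; _*_; _<_; _≤_; _<ᵇ_)
open import Data.Bool using (Bool; true; false; if_then_else_)
open import Data.List using (List; []; _∷_; length; map; concatMap; filterᵇ)
open import Data.Vec using (Vec; []; _∷_)
open import Data.Fin using (Fin; inject₁) renaming (suc to fsuc)
import Data.Vec.Functional as VF
open import Data.Fin.Subset using (Subset; _∈_; ∣_∣)
open import Data.Product using (Σ; _×_)
open import Relation.Binary.PropositionalEquality using (_≡_; _≢_)

data Letter : Set where
  A B : Letter

isA : Letter → Bool
isA A = true
isA B = false

-- An edge of an r-uniform ordered hypergraph: its r vertices (natural numbers,
-- with the order of ℕ) listed in increasing order.
Edge : ℕ → Set
Edge r = Fin r → ℕ

Increasing : {r : ℕ} → Edge r → Set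
Increasing {r} e = (i j : Fin r) → Data.Fin._<_ i j → e i < e j

Disjoint : {r : ℕ} → Edge r → Edge r → Set
Disjoint {r} e f = (i j : Fin r) → e i ≢ f j

record OrderedMatching (r N : ℕ) : Set where
  field
    edge       : Fin N → Edge r
    increasing : (a : Fin N) → Increasing (edge a)
    disjoint   : (a b : Fin N) → a ≢ b → Disjoint (edge a) (edge b)
open OrderedMatching public

-- r-partite (stated for r = suc k, so that "i-th" and "(i+1)-th" are inject₁ i, suc i)
Partite : {k N : ℕ} → OrderedMatching (suc k) N → Set
Partite {k} {N} H = (a b : Fin N) (i : Fin k) →
  edge H a (inject₁ i) < edge H b (fsuc i)

merge : List ℕ → List ℕ → List Letter
merge [] ys = map (λ _ → B) ys
merge (x ∷ xs) [] = A ∷ merge xs []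
merge (x ∷ xs) (y ∷ ys) =
  if x <ᵇ y then A ∷ merge xs (y ∷ ys) else B ∷ merge (x ∷ xs) ys

-- smallest vertex of an edge (0 for the degenerate r = 0)
firstVertex : {r : ℕ} → Edge r → ℕ
firstVertex {zero} e = 0
firstVertex {suc r} e = e Data.Fin.zero

form : {r : ℕ} → Edge r → Edge r → List Letter
form e f =
  if firstVertex e <ᵇ firstVertex f
  then merge (VF.toList e) (VF.toList f)
  else merge (VF.toList f) (VF.toList e)

data StartsWithA : List Letter → Set where
  startA : (w : List Letter) → StartsWithA (A ∷ w)

IsPattern : ℕ → List Letter → Set
IsPattern r P = (length P ≡ r + r) × StartsWithA P × (length (filterᵇ isA P) ≡ r)

IsClique : {r N : ℕ} → OrderedMatching r N → List Letter → Subset N → Set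
IsClique {r} {N} H P S =
  (a b : Fin N) → a ∈ S → b ∈ S → a ≢ b → form (edge H a) (edge H b) ≡ P

CliquesBounded : {r N : ℕ} → OrderedMatching r N → List Letter → ℕ → Set
CliquesBounded {r} {N} H P m = (S : Subset N) → IsClique H P S → ∣ S ∣ ≤ m

-- the patterns in 𝒫((1,…,1)) for r = suc k: the first block is AB (pattern
-- starts with A), the remaining k blocks are AB (false) or BA (true).
block : Bool → List Letter
block false = A ∷ B ∷ []
block true  = B ∷ A ∷ []

blocksToList : {k : ℕ} → Vec Bool k → List Letter
blocksToList [] = []
blocksToList (b ∷ bs) = block b Data.List.++ blocksToList bs

onesPattern : {k : ℕ} → Vec Bool k → List Letter
onesPattern c = A ∷ B ∷ blocksToList c

InOnes : ℕ → List Letter → Set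
InOnes k P = Σ (Vec Bool k) (λ c → onesPattern c ≡ P)

allChoices : (k : ℕ) → List (Vec Bool k)
allChoices zero = [] ∷ []
allChoices (suc k) =
  map (false ∷_) (allChoices k) Data.List.++ map (true ∷_) (allChoices k)

{-# OPTIONS --safe #-}
-- Read an edge index a < N = ∏ m_c as a mixed-radix numeral with one digit d_c(a) < m_c for every
-- choice vector c, and place the j-th vertex of edge a in the j-th of k + 1 consecutive intervals of
-- length N, at the position of a with each digit d_c reflected (d ↦ m_c − 1 − d) exactly when block j
-- of c is BA. In every interval two distinct edges are then ordered by their first differing digit c,
-- flipped exactly in the intervals where block j of c is BA, so they form precisely the pattern of c.
-- Hence no pattern outside 𝒫((1,…,1)) has a clique of size 2, and the edges of a clique for the
-- pattern of c have pairwise distinct digits d_c, so there are at most m_c of them.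
module Submission where

open import Defs
open import Data.Nat using (ℕ; zero; suc; pred; _+_; _*_; _∸_; _<_; _≤_; _<ᵇ_; z≤n; s≤s; z<s; NonZero; >-nonZero)
open import Data.Nat.Properties renaming (_≟_ to _≟ℕ_)
open import Data.Nat.DivMod using (_/_; _%_; m%n<n; m<n*o⇒m/o<n; m≡m%n+[m/n]*n)
open import Data.Nat.ListAction using (product)
open import Data.Bool using (Bool; true; false; not; T; if_then_else_)
open import Data.Bool.Properties using (not-involutive) renaming (_≟_ to _≟ᵇ_)
open import Data.Unit using (tt)
open import Data.Fin using (Fin; toℕ; inject₁) renaming (zero to fzero; suc to fsuc)
open import Data.Fin.Properties using (toℕ<n; toℕ-injective; toℕ-inject₁) renaming (_≟_ to _≟ᶠ_; suc-injective to fsuc-injective)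
open import Data.Fin.Subset using (Subset; _∈_; ∣_∣)
open import Data.Vec using (Vec; []; _∷_; lookup; tabulate)
import Data.Vec as Vec
open import Data.Vec.Properties using (∷-injectiveʳ; ≡-dec; tabulate-cong; tabulate∘lookup)
import Data.Vec.Functional as VF
open import Data.List using (List; []; _∷_; map; _++_; drop)
open import Data.List.Relation.Unary.Any using (here; there)
import Data.List.Relation.Unary.All as All
open import Data.List.Relation.Unary.AllPairs using ([]; _∷_)
open import Data.List.Relation.Unary.Unique.Propositional using (Unique)
import Data.List.Relation.Unary.Unique.Propositional.Properties as Unique
open import Data.List.Membership.Propositional using () renaming (_∈_ to _∈ₗ_)
open import Data.List.Membership.Propositional.Properties using (∈-map⁻)
open import Data.Product using (Σ; _×_; _,_)
open import Function using (_∘_)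
open import Relation.Nullary using (¬_; yes; no; contradiction)
open import Relation.Nullary.Decidable using (decidable-stable)
open import Relation.Binary.Definitions using (DecidableEquality; tri<; tri≈; tri>)
open import Relation.Binary.PropositionalEquality

<⇒<ᵇ≡true : ∀ {x y} → x < y → (x <ᵇ y) ≡ true
<⇒<ᵇ≡true {x} {y} x<y with x <ᵇ y | <⇒<ᵇ x<y
... | true | _ = refl

≤⇒<ᵇ≡false : ∀ {x y} → y ≤ x → (x <ᵇ y) ≡ false
≤⇒<ᵇ≡false {x} {y} y≤x with x <ᵇ y in eq
... | false = refl
... | true  = contradiction (<ᵇ⇒< x y (subst T (sym eq) tt)) (≤⇒≯ y≤x)

*+-<-lex : ∀ {X₁ X₂ R₁ M} R₂ → X₁ < X₂ → R₁ < M → X₁ * M + R₁ < X₂ * M + R₂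
*+-<-lex {X₁} {X₂} {R₁} {M} R₂ X₁<X₂ R₁<M = begin-strict
  X₁ * M + R₁ <⟨ +-monoʳ-< (X₁ * M) R₁<M ⟩
  X₁ * M + M  ≡⟨ +-comm (X₁ * M) M ⟩
  suc X₁ * M  ≤⟨ *-monoˡ-≤ M X₁<X₂ ⟩
  X₂ * M      ≤⟨ m≤m+n (X₂ * M) R₂ ⟩
  X₂ * M + R₂ ∎
  where open ≤-Reasoning

*+-<-* : ∀ {X₁ X₂ R₁ M} → X₁ < X₂ → R₁ < M → X₁ * M + R₁ < X₂ * M
*+-<-* {X₁} {X₂} {R₁} {M} X₁<X₂ R₁<M =
  subst (X₁ * M + R₁ <_) (+-identityʳ (X₂ * M)) (*+-<-lex 0 X₁<X₂ R₁<M)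

data SameOrder (x y p q : ℕ) : Set where
  both< : x < y → p < q → SameOrder x y p q
  both> : y < x → q < p → SameOrder x y p q

module _ {x y p q : ℕ} where

  sameOrder-sym : SameOrder x y p q → SameOrder y x q p
  sameOrder-sym (both< x<y p<q) = both> x<y p<q
  sameOrder-sym (both> y<x q<p) = both< y<x q<p

  sameOrder-≢ : SameOrder x y p q → x ≢ y
  sameOrder-≢ (both< x<y _) = <⇒≢ x<y
  sameOrder-≢ (both> y<x _) = ≢-sym (<⇒≢ y<x)

  sameOrder-≢ʳ : SameOrder x y p q → p ≢ q
  sameOrder-≢ʳ (both< _ p<q) = <⇒≢ p<q
  sameOrder-≢ʳ (both> _ q<p) = ≢-sym (<⇒≢ q<p)

  sameOrder-< : SameOrder x y p q → p < q → x < y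
  sameOrder-< (both< x<y _)   _   = x<y
  sameOrder-< (both> _   q<p) p<q = contradiction p<q (<⇒≯ q<p)

  sameOrder-<ᵇ : SameOrder x y p q → (x <ᵇ y) ≡ (p <ᵇ q)
  sameOrder-<ᵇ (both< x<y p<q) = trans (<⇒<ᵇ≡true x<y) (sym (<⇒<ᵇ≡true p<q))
  sameOrder-<ᵇ (both> y<x q<p) = trans (≤⇒<ᵇ≡false (<⇒≤ y<x)) (sym (≤⇒<ᵇ≡false (<⇒≤ q<p)))

  sameOrder-+ : ∀ n → SameOrder x y p q → SameOrder (n + x) (n + y) p q
  sameOrder-+ n (both< x<y p<q) = both< (+-monoʳ-< n x<y) p<q
  sameOrder-+ n (both> y<x q<p) = both> (+-monoʳ-< n y<x) q<p

  sameOrder-*+ : ∀ {M R₁ R₂} → R₁ < M → R₂ < M →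
    SameOrder x y p q → SameOrder (x * M + R₁) (y * M + R₂) p q
  sameOrder-*+ {R₁ = R₁} {R₂} R₁<M R₂<M (both< x<y p<q) = both< (*+-<-lex R₂ x<y R₁<M) p<q
  sameOrder-*+ {R₁ = R₁} {R₂} R₁<M R₂<M (both> y<x q<p) = both> (*+-<-lex R₁ y<x R₂<M) q<p

≢⇒sameOrder : ∀ {p q} → p ≢ q → SameOrder p q p q
≢⇒sameOrder {p} {q} p≢q with <-cmp p q
... | tri< p<q _ _ = both< p<q p<q
... | tri≈ _ p≡q _ = contradiction p≡q p≢q
... | tri> _ _ q<p = both> q<p q<p

reflect : Bool → ℕ → ℕ → ℕ
reflect false M d = d
reflect true  M d = M ∸ suc d

reflect-< : ∀ β {M d} → d < M → reflect β M d < M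
reflect-< false d<M = d<M
reflect-< true {suc M} {d} _ = s≤s (m∸n≤m M d)

reflect-injective : ∀ β {M d₁ d₂} → d₁ < M → d₂ < M →
  reflect β M d₁ ≡ reflect β M d₂ → d₁ ≡ d₂
reflect-injective false _ _ eq = eq
reflect-injective true d₁<M d₂<M eq = suc-injective (∸-cancelˡ-≡ d₁<M d₂<M eq)

reflect-<ᵇ : ∀ β {M d₁ d₂} → d₁ < d₂ → d₂ < M → (reflect β M d₁ <ᵇ reflect β M d₂) ≡ not β
reflect-<ᵇ false d₁<d₂ _ = <⇒<ᵇ≡true d₁<d₂
reflect-<ᵇ true {M} d₁<d₂ _ = ≤⇒<ᵇ≡false (∸-monoʳ-≤ M (s≤s (<⇒≤ d₁<d₂)))

≮∧≢⇒> : ∀ {v w} → ¬ w < v → w ≢ v → v < w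
≮∧≢⇒> w≮v w≢v = ≤∧≢⇒< (≮⇒≥ w≮v) (≢-sym w≢v)

<∧<⇒≢pred : ∀ {v w₁ w₂} → w₁ < v → v < w₂ → w₁ ≢ pred w₂
<∧<⇒≢pred w₁<v v<w₂ refl = <⇒≱ w₁<v (<⇒≤pred v<w₂)

punchOutℕ : ℕ → ℕ → ℕ
punchOutℕ v w with w <? v
... | yes _ = w
... | no  _ = pred w

punchOutℕ-< : ∀ {v w M} → v < suc M → w < suc M → w ≢ v → punchOutℕ v w < M
punchOutℕ-< {v} {w} v≤M w≤M w≢v with w <? v
... | yes w<v = <-≤-trans w<v (≤-pred v≤M)
... | no  w≮v = pred-< (≮∧≢⇒> w≮v w≢v) w≤M
  where
  pred-< : ∀ {v w M} → v < w → w < suc M → pred w < M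
  pred-< {w = suc w} _ (s≤s w<M) = w<M

punchOutℕ-injective : ∀ {v w₁ w₂} → w₁ ≢ v → w₂ ≢ v →
  punchOutℕ v w₁ ≡ punchOutℕ v w₂ → w₁ ≡ w₂
punchOutℕ-injective {v} {w₁} {w₂} w₁≢v w₂≢v eq with w₁ <? v | w₂ <? v
... | yes _   | yes _   = eq
... | yes w₁<v | no w₂≮v = contradiction eq (<∧<⇒≢pred w₁<v (≮∧≢⇒> w₂≮v w₂≢v))
... | no w₁≮v | yes w₂<v = contradiction (sym eq) (<∧<⇒≢pred w₂<v (≮∧≢⇒> w₁≮v w₁≢v))
... | no w₁≮v | no w₂≮v = pred-injective
  {{>-nonZero (m<n⇒0<n (≮∧≢⇒> w₁≮v w₁≢v))}}
  {{>-nonZero (m<n⇒0<n (≮∧≢⇒> w₂≮v w₂≢v))}} eq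

injectiveOn⇒∣p∣≤ : ∀ {n M} (p : Subset n) (f : Fin n → ℕ) → (∀ {a} → a ∈ p → f a < M) →
  (∀ {a b} → a ∈ p → b ∈ p → f a ≡ f b → a ≡ b) → ∣ p ∣ ≤ M
injectiveOn⇒∣p∣≤ [] f f<M inj = z≤n
injectiveOn⇒∣p∣≤ (false ∷ p) f f<M inj =
  injectiveOn⇒∣p∣≤ p (λ a → f (fsuc a)) (λ a∈p → f<M (Vec.there a∈p))
    (λ a∈p b∈p eq → fsuc-injective (inj (Vec.there a∈p) (Vec.there b∈p) eq))
injectiveOn⇒∣p∣≤ {M = zero} (true ∷ p) f f<M inj = contradiction (f<M Vec.here) λ ()
injectiveOn⇒∣p∣≤ {M = suc M} (true ∷ p) f f<M inj =
  s≤s (injectiveOn⇒∣p∣≤ p g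
    (λ a∈p → punchOutℕ-< (f<M Vec.here) (f<M (Vec.there a∈p)) (≢f₀ a∈p))
    (λ a∈p b∈p eq → fsuc-injective
      (inj (Vec.there a∈p) (Vec.there b∈p) (punchOutℕ-injective (≢f₀ a∈p) (≢f₀ b∈p) eq))))
  where
  g : Fin _ → ℕ
  g a = punchOutℕ (f fzero) (f (fsuc a))
  ≢f₀ : ∀ {a} → a ∈ p → f (fsuc a) ≢ f fzero
  ≢f₀ a∈p eq with inj (Vec.there a∈p) Vec.here eq
  ... | ()

∣p∣≤1 : ∀ {n} (p : Subset n) → (∀ {a b} → a ∈ p → b ∈ p → a ≡ b) → ∣ p ∣ ≤ 1
∣p∣≤1 p all-equal = injectiveOn⇒∣p∣≤ p (λ _ → 0) (λ _ → z<s) (λ a∈p b∈p _ → all-equal a∈p b∈p)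

Interleaved : ∀ {k} → Edge (suc k) → Edge (suc k) → Set
Interleaved {k} e f = (i : Fin k) → e (inject₁ i) < f (fsuc i) × f (inject₁ i) < e (fsuc i)

merge-interleaved : ∀ {k} (e f : Edge (suc k)) → Interleaved e f →
  merge (VF.toList e) (VF.toList f) ≡ blocksToList (tabulate λ i → not (e i <ᵇ f i))
merge-interleaved {zero} e f _ with e fzero <ᵇ f fzero
... | true  = refl
... | false = refl
merge-interleaved {suc k} e f ef with e fzero <ᵇ f fzero | ef fzero
... | true  | _ , f₀<e₁ rewrite ≤⇒<ᵇ≡false (<⇒≤ f₀<e₁) =
  cong (λ w → A ∷ B ∷ w) (merge-interleaved (e ∘ fsuc) (f ∘ fsuc) (ef ∘ fsuc))
... | false | e₀<f₁ , _ rewrite <⇒<ᵇ≡true e₀<f₁ =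
  cong (λ w → B ∷ A ∷ w) (merge-interleaved (e ∘ fsuc) (f ∘ fsuc) (ef ∘ fsuc))

form-interleaved : ∀ {k} (e f : Edge (suc k)) → (e fzero <ᵇ f fzero) ≡ true → Interleaved e f →
  form e f ≡ onesPattern (tabulate λ i → not (e (fsuc i) <ᵇ f (fsuc i)))
form-interleaved e f e₀<f₀ ef = begin
  form e f
    ≡⟨ cong (λ b → if b then merge es fs else merge fs es) e₀<f₀ ⟩
  merge es fs
    ≡⟨ merge-interleaved e f ef ⟩
  block (not (e fzero <ᵇ f fzero)) ++ blocksToList rest
    ≡⟨ cong (λ b → block (not b) ++ blocksToList rest) e₀<f₀ ⟩
  onesPattern rest ∎
  where
  open ≡-Reasoning
  es fs : List ℕ
  es = VF.toList e
  fs = VF.toList f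
  rest : Vec Bool _
  rest = tabulate λ i → not (e (fsuc i) <ᵇ f (fsuc i))

form-comm : ∀ {k} (e f : Edge (suc k)) → f fzero < e fzero → form e f ≡ form f e
form-comm e f f₀<e₀ rewrite ≤⇒<ᵇ≡false (<⇒≤ f₀<e₀) | <⇒<ᵇ≡true f₀<e₀ = refl

blocksToList-injective : ∀ {k} (c c′ : Vec Bool k) → blocksToList c ≡ blocksToList c′ → c ≡ c′
blocksToList-injective [] [] _ = refl
blocksToList-injective (false ∷ c) (false ∷ c′) eq =
  cong (false ∷_) (blocksToList-injective c c′ (cong (drop 2) eq))
blocksToList-injective (true ∷ c) (true ∷ c′) eq =
  cong (true ∷_) (blocksToList-injective c c′ (cong (drop 2) eq))

onesPattern-injective : ∀ {k} (c c′ : Vec Bool k) → onesPattern c ≡ onesPattern c′ → c ≡ c′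
onesPattern-injective c c′ eq = blocksToList-injective c c′ (cong (drop 2) eq)

allChoices-unique : ∀ k → Unique (allChoices k)
allChoices-unique zero = All.[] ∷ []
allChoices-unique (suc k) =
  Unique.++⁺ (Unique.map⁺ ∷-injectiveʳ (allChoices-unique k))
             (Unique.map⁺ ∷-injectiveʳ (allChoices-unique k)) halves-disjoint
  where
  halves-disjoint : ∀ {c} →
    ¬ (c ∈ₗ map (false ∷_) (allChoices k) × c ∈ₗ map (true ∷_) (allChoices k))
  halves-disjoint (p , q) with ∈-map⁻ (false ∷_) p | ∈-map⁻ (true ∷_) q
  ... | _ , _ , refl | _ , _ , ()

module MixedRadix {X : Set} (_≟_ : DecidableEquality X) (m : X → ℕ) (m>0 : ∀ x → 0 < m x) where

  size : List X → ℕ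
  size L = product (map m L)

  size-nonZero : ∀ L → NonZero (size L)
  size-nonZero []      = _
  size-nonZero (x ∷ L) = m*n≢0 (m x) (size L) {{>-nonZero (m>0 x)}} {{size-nonZero L}}

  quot rem : List X → ℕ → ℕ
  quot L a = _/_ a (size L) {{size-nonZero L}}
  rem  L a = _%_ a (size L) {{size-nonZero L}}

  quot-< : ∀ {x} L {a} → a < size (x ∷ L) → quot L a < m x
  quot-< L = m<n*o⇒m/o<n {{size-nonZero L}}

  rem-< : ∀ L a → rem L a < size L
  rem-< L a = m%n<n a (size L) {{size-nonZero L}}

  quot-rem : ∀ L a → a ≡ rem L a + quot L a * size L
  quot-rem L a = m≡m%n+[m/n]*n a (size L) {{size-nonZero L}}

  digit : List X → X → ℕ → ℕ
  digit []      x a = 0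
  digit (y ∷ L) x a with x ≟ y
  ... | yes _ = quot L a
  ... | no  _ = digit L x (rem L a)

  digit-here : ∀ x L a → digit (x ∷ L) x a ≡ quot L a
  digit-here x L a with x ≟ x
  ... | yes _ = refl
  ... | no x≢x = contradiction refl x≢x

  digit-there : ∀ {x y} L a → x ≢ y → digit (y ∷ L) x a ≡ digit L x (rem L a)
  digit-there {x} {y} L a x≢y with x ≟ y
  ... | yes x≡y = contradiction x≡y x≢y
  ... | no  _   = refl

  digit-< : ∀ L x {a} → a < size L → digit L x a < m x
  digit-< []      x _ = m>0 x
  digit-< (y ∷ L) x {a} a<size with x ≟ y
  ... | yes refl = quot-< L a<size
  ... | no  _    = digit-< L x (rem-< L a)

  reflectDigits : List X → (X → Bool) → ℕ → ℕ
  reflectDigits []      t a = 0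
  reflectDigits (y ∷ L) t a = reflect (t y) (m y) (quot L a) * size L + reflectDigits L t (rem L a)

  reflectDigits-< : ∀ L t {a} → a < size L → reflectDigits L t a < size L
  reflectDigits-< []      t _ = z<s
  reflectDigits-< (y ∷ L) t {a} a<size =
    *+-<-* (reflect-< (t y) (quot-< L a<size)) (reflectDigits-< L t (rem-< L a))

  FirstDifference : List X → ℕ → ℕ → Set
  FirstDifference L a b = Σ X λ x → x ∈ₗ L × ∀ t →
    SameOrder (reflectDigits L t a) (reflectDigits L t b)
              (reflect (t x) (m x) (digit L x a)) (reflect (t x) (m x) (digit L x b))

  firstDifference : ∀ L → Unique L → ∀ {a b} → a < size L → b < size L → a ≢ b →
    FirstDifference L a b
  firstDifference [] _ (s≤s z≤n) (s≤s z≤n) a≢b = contradiction refl a≢b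
  firstDifference (y ∷ L) (y∉L ∷ uL) {a} {b} a<size b<size a≢b with quot L a ≟ℕ quot L b
  ... | no quot≢ = y , here refl , differAtHead
    where
    differAtHead : ∀ t → SameOrder (reflectDigits (y ∷ L) t a) (reflectDigits (y ∷ L) t b)
      (reflect (t y) (m y) (digit (y ∷ L) y a)) (reflect (t y) (m y) (digit (y ∷ L) y b))
    differAtHead t rewrite digit-here y L a | digit-here y L b =
      sameOrder-*+ (reflectDigits-< L t (rem-< L a)) (reflectDigits-< L t (rem-< L b))
        (≢⇒sameOrder (quot≢ ∘ reflect-injective (t y) (quot-< L a<size) (quot-< L b<size)))
  ... | yes quot≡ with firstDifference L uL (rem-< L a) (rem-< L b) rem≢
    where
    rem≢ : rem L a ≢ rem L b
    rem≢ rem≡ = a≢b (begin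
      a                           ≡⟨ quot-rem L a ⟩
      rem L a + quot L a * size L ≡⟨ cong₂ (λ r q → r + q * size L) rem≡ quot≡ ⟩
      rem L b + quot L b * size L ≡⟨ quot-rem L b ⟨
      b                           ∎)
      where open ≡-Reasoning
  ... | x , x∈L , differAtTail = x , there x∈L , differInTail
    where
    x≢y : x ≢ y
    x≢y x≡y = All.lookup y∉L x∈L (sym x≡y)
    differInTail : ∀ t → SameOrder (reflectDigits (y ∷ L) t a) (reflectDigits (y ∷ L) t b)
      (reflect (t x) (m x) (digit (y ∷ L) x a)) (reflect (t x) (m x) (digit (y ∷ L) x b))
    differInTail t rewrite digit-there L a x≢y | digit-there L b x≢y | quot≡ =
      sameOrder-+ (reflect (t y) (m y) (quot L b) * size L) (differAtTail t)

module Construction (k : ℕ) (m : Vec Bool k → ℕ) (m>0 : ∀ c → 0 < m c) where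

  open MixedRadix (≡-dec _≟ᵇ_) m m>0

  L : List (Vec Bool k)
  L = allChoices k

  N : ℕ
  N = size L

  digitOf : Vec Bool k → Fin N → ℕ
  digitOf c a = digit L c (toℕ a)

  digitOf-< : ∀ c a → digitOf c a < m c
  digitOf-< c a = digit-< L c (toℕ<n a)

  -- The first block of every pattern in 𝒫((1,…,1)) is AB, so layer 0 reflects no digit.
  reversedIn : Fin (suc k) → Vec Bool k → Bool
  reversedIn fzero    _ = false
  reversedIn (fsuc i) c = lookup c i

  vertex : Fin N → Edge (suc k)
  vertex a j = toℕ j * N + reflectDigits L (reversedIn j) (toℕ a)

  vertex-<-layer : ∀ {i j} a b → toℕ i < toℕ j → vertex a i < vertex b j
  vertex-<-layer {i} {j} a b i<j =
    *+-<-lex (reflectDigits L (reversedIn j) (toℕ b)) i<j (reflectDigits-< L (reversedIn i) (toℕ<n a))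

  LayerwiseOrder : Fin N → Fin N → Vec Bool k → Set
  LayerwiseOrder a b c = ∀ j → SameOrder (vertex a j) (vertex b j)
    (reflect (reversedIn j c) (m c) (digitOf c a)) (reflect (reversedIn j c) (m c) (digitOf c b))

  firstDifferenceOf : ∀ {a b} → a ≢ b → Σ (Vec Bool k) (LayerwiseOrder a b)
  firstDifferenceOf {a} {b} a≢b
    with firstDifference L (allChoices-unique k) (toℕ<n a) (toℕ<n b) (a≢b ∘ toℕ-injective)
  ... | c , _ , differ = c , λ j → sameOrder-+ (toℕ j * N) (differ (reversedIn j))

  partite : ∀ a b (i : Fin k) → vertex a (inject₁ i) < vertex b (fsuc i)
  partite a b i = vertex-<-layer a b (subst (_< suc (toℕ i)) (sym (toℕ-inject₁ i)) (n<1+n (toℕ i)))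

  form-layerwise : ∀ {a b c} → LayerwiseOrder a b c → digitOf c a < digitOf c b →
    form (vertex a) (vertex b) ≡ onesPattern c
  form-layerwise {a} {b} {c} order a<b =
    trans (form-interleaved (vertex a) (vertex b) firstLayer (λ i → partite a b i , partite b a i))
          (cong onesPattern (trans (tabulate-cong laterLayer) (tabulate∘lookup c)))
    where
    firstLayer : (vertex a fzero <ᵇ vertex b fzero) ≡ true
    firstLayer = <⇒<ᵇ≡true (sameOrder-< (order fzero) a<b)
    laterLayer : ∀ i → not (vertex a (fsuc i) <ᵇ vertex b (fsuc i)) ≡ lookup c i
    laterLayer i = begin
      not (vertex a (fsuc i) <ᵇ vertex b (fsuc i))
        ≡⟨ cong not (sameOrder-<ᵇ (order (fsuc i))) ⟩
      not (reflect (lookup c i) (m c) (digitOf c a) <ᵇ reflect (lookup c i) (m c) (digitOf c b))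
        ≡⟨ cong not (reflect-<ᵇ (lookup c i) a<b (digitOf-< c b)) ⟩
      not (not (lookup c i))
        ≡⟨ not-involutive (lookup c i) ⟩
      lookup c i ∎
      where open ≡-Reasoning

  pairPattern : ∀ {a b} → a ≢ b →
    Σ (Vec Bool k) λ c → digitOf c a ≢ digitOf c b × form (vertex a) (vertex b) ≡ onesPattern c
  pairPattern {a} {b} a≢b with firstDifferenceOf a≢b
  ... | c , order with <-cmp (digitOf c a) (digitOf c b)
  ... | tri< a<b _ _ = c , <⇒≢ a<b , form-layerwise order a<b
  ... | tri≈ _ a≡b _ = contradiction a≡b (sameOrder-≢ʳ (order fzero))
  ... | tri> _ _ b<a = c , ≢-sym (<⇒≢ b<a) ,
    trans (form-comm (vertex a) (vertex b) (sameOrder-< (sameOrder-sym (order fzero)) b<a))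
          (form-layerwise (sameOrder-sym ∘ order) b<a)

  matching : OrderedMatching (suc k) N
  matching = record { edge = vertex ; increasing = vertex-increasing ; disjoint = vertices-disjoint }
    where
    vertex-increasing : ∀ a → Increasing (vertex a)
    vertex-increasing a i j = vertex-<-layer a a
    vertices-disjoint : ∀ a b → a ≢ b → Disjoint (vertex a) (vertex b)
    vertices-disjoint a b a≢b i j with <-cmp (toℕ i) (toℕ j)
    ... | tri< i<j _ _ = <⇒≢ (vertex-<-layer a b i<j)
    ... | tri> _ _ j<i = ≢-sym (<⇒≢ (vertex-<-layer b a j<i))
    ... | tri≈ _ i≡j _ with toℕ-injective i≡j
    ... | refl with firstDifferenceOf a≢b
    ... | c , order = sameOrder-≢ (order i)

  onesCliques : ∀ c → CliquesBounded matching (onesPattern c) (m c)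
  onesCliques c S clique = injectiveOn⇒∣p∣≤ S (digitOf c) (λ {a} _ → digitOf-< c a) injective
    where
    injective : ∀ {a b} → a ∈ S → b ∈ S → digitOf c a ≡ digitOf c b → a ≡ b
    injective {a} {b} a∈S b∈S eq = decidable-stable (a ≟ᶠ b) λ a≢b →
      let c′ , differ , formed = pairPattern a≢b
          c′≡c = onesPattern-injective c′ c (trans (sym formed) (clique a b a∈S b∈S a≢b))
      in differ (subst (λ d → digitOf d a ≡ digitOf d b) (sym c′≡c) eq)

  otherCliques : ∀ P → IsPattern (suc k) P → ¬ InOnes k P → CliquesBounded matching P 1
  otherCliques P _ notOnes S clique = ∣p∣≤1 S noPairs
    where
    noPairs : ∀ {a b} → a ∈ S → b ∈ S → a ≡ b
    noPairs {a} {b} a∈S b∈S = decidable-stable (a ≟ᶠ b) λ a≢b →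
      let c , _ , formed = pairPattern a≢b
      in notOnes (c , trans (sym formed) (clique a b a∈S b∈S a≢b))

lemma4p3 : (k : ℕ) (m : Vec Bool k → ℕ) → ((c : Vec Bool k) → 0 < m c) →
    Σ (OrderedMatching (suc k) (product (map m (allChoices k)))) (λ H →
      Partite H
      × ((c : Vec Bool k) → CliquesBounded H (onesPattern c) (m c))
      × ((P : List Letter) → IsPattern (suc k) P → ¬ InOnes k P →
           CliquesBounded H P 1))
lemma4p3 k m m>0 = matching , partite , onesCliques , otherCliques
  where open Construction k m m>0
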